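{- Let $r \ge 3$, $p \ge 0$ be integers and $\sigma > 0$. If $G$ is a graph on $n$ vertices and $U \subseteq V(G)$, then there are at least $|U| - \sigma n$ vertices $u \in U$ such that at most $\sigma n^p$ of the $(r-2)$-walks of length $p$ contained in $N(u)$ are $(U, \sigma^2)$-poor.
   Context: An ordered sequence $x_1,\dotsc,x_p$ of vertices of $G$ is an $(r-2)$-walk of length $p$ if every $r-1$ consecutive vertices of the sequence form a clique in $G$. A walk is contained in $N(u)$ if all its vertices are neighbours of $u$. For $U \subseteq V(G)$ and $\sigma>0$, a walk (or vertex set) $W$ is $(U,\sigma)$-rich if there are at least $\sigma n$ vertices $u \in U$ for which $N(u)$ contains $W$, and is $(U,\sigma)$-poor otherwise.
   Formalization: The parameter σ ranges over the positive rationals. -}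

module Defs where

open import Data.Bool using (Bool; true; false; _∧_; not; if_then_else_)
open import Data.Nat using (ℕ; zero; suc; _+_; _∸_; _^_; _≤ᵇ_; _<ᵇ_)
open import Data.Fin using (Fin; toℕ)
open import Data.Fin.Subset using (Subset)
open import Data.List using (List; []; _∷_; map; concatMap; length; filterᵇ; upTo; allFin)
open import Data.Vec using (Vec; lookup)
import Data.Vec as V
open import Data.Integer using (+_)
open import Data.Rational using (ℚ; _/_; _*_) renaming (_≤ᵇ_ to _≤ℚᵇ_)
open import Relation.Binary.PropositionalEquality using (_≡_)

record Graph (n : ℕ) : Set where
  field
    adj    : Fin n → Fin n → Bool
    sym    : ∀ x y → adj x y ≡ adj y x
    irrefl : ∀ x → adj x x ≡ false
open Graph public

allᵇ : {A : Set} → (A → Bool) → List A → Bool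
allᵇ P []       = true
allᵇ P (x ∷ xs) = P x ∧ allᵇ P xs

ℕ→ℚ : ℕ → ℚ
ℕ→ℚ k = + k / 1

countᵇ : {A : Set} → (A → Bool) → List A → ℕ
countᵇ P xs = length (filterᵇ P xs)

allSeqs : (n p : ℕ) → List (Vec (Fin n) p)
allSeqs n zero    = V.[] ∷ []
allSeqs n (suc p) = concatMap (λ w → map (λ x → x V.∷ w) (allFin n)) (allSeqs n p)

module _ {n : ℕ} (G : Graph n) where

  -- W is an (r-2)-walk: every r-1 consecutive vertices (positions s,…,s+r-2,
  -- for each start s with s+r-1 ≤ p) form a clique, i.e. are pairwise adjacent
  -- (adjacency is irreflexive, so they are in particular distinct).
  isWalk : (r : ℕ) {p : ℕ} → Vec (Fin n) p → Bool
  isWalk r {p} W =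
    allᵇ (λ s → if (s + (r ∸ 1)) ≤ᵇ p
               then allᵇ (λ i → allᵇ (λ j →
                      if (s ≤ᵇ toℕ i) ∧ (toℕ i <ᵇ toℕ j) ∧ (toℕ j ≤ᵇ s + (r ∸ 2))
                      then adj G (lookup W i) (lookup W j)
                      else true) (allFin p)) (allFin p)
               else true)
        (upTo (suc p))

  containedIn : {p : ℕ} → Fin n → Vec (Fin n) p → Bool
  containedIn {p} u W = allᵇ (λ i → adj G u (lookup W i)) (allFin p)

  richCount : {p : ℕ} → Subset n → Vec (Fin n) p → ℕ
  richCount U W = countᵇ (λ u → lookup U u ∧ containedIn u W) (allFin n)

  isPoor : {p : ℕ} → Subset n → ℚ → Vec (Fin n) p → Bool
  isPoor U τ W = not ((τ * ℕ→ℚ n) ≤ℚᵇ ℕ→ℚ (richCount U W))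

  poorWalksIn : (r p : ℕ) → Subset n → ℚ → Fin n → ℕ
  poorWalksIn r p U τ u =
    countᵇ (λ W → isWalk r W ∧ containedIn u W ∧ isPoor U τ W) (allSeqs n p)

  goodCount : (r p : ℕ) → Subset n → ℚ → ℕ
  goodCount r p U σ =
    countᵇ (λ u → lookup U u ∧
                  (ℕ→ℚ (poorWalksIn r p U (σ * σ) u) ≤ℚᵇ σ * ℕ→ℚ (n ^ p)))
           (allFin n)

-- Double counting. Call u ∈ U bad if more than σ nᵖ of the walks in N(u) are
-- (U,σ²)-poor, and count the pairs (u, W) with u ∈ U and W a poor walk in N(u).
-- Each bad u lies in more than σ nᵖ such pairs, while each of the nᵖ vertex
-- sequences W lies in fewer than σ² n of them (in none unless W is poor).
-- Hence #bad · σ nᵖ ≤ nᵖ · σ² n, i.e. #bad ≤ σ n.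
module Submission where

open import Algebra.Properties.CommutativeSemigroup using (interchange)
open import Data.Bool using (Bool; true; false; _∧_; not; T)
open import Data.Bool.Properties using (T-∧; T-≡; T-not-≡)
open import Data.Empty using (⊥-elim)
open import Data.Fin using (Fin)
import Data.Fin as Fin
open import Data.Fin.Subset using (Subset; ∣_∣; inside; outside)
import Data.Integer as ℤ
import Data.Integer.Properties as ℤ
open import Data.List using (List; []; _∷_; length; map; concatMap; allFin)
import Data.List.Properties as List
open import Data.Nat as ℕ using (ℕ; zero; suc; _+_; _^_; _≤_; z≤n; s≤s; NonZero)
import Data.Nat.Coprimality as Coprimality
import Data.Nat.Properties as ℕ
open import Data.Product using (_×_; _,_; proj₁; proj₂)
open import Data.Rational as ℚ using (ℚ; 0ℚ; _-_; _*_; mkℚ; _/_)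
  renaming (_<_ to _<ℚ_; _≤_ to _≤ℚ_)
import Data.Rational.Properties as ℚ
open import Data.Rational.Solver using (module +-*-Solver)
open import Data.Unit using (tt)
open import Data.Vec using (Vec; []; _∷_; lookup)
open import Defs hiding (sym)
open import Function using (id; _∘_; Equivalence)
open import Relation.Binary.PropositionalEquality
open import Relation.Nullary using (¬_)

private variable
  A B : Set

𝟙 : Bool → ℕ
𝟙 true  = 1
𝟙 false = 0

∑ : List A → (A → ℕ) → ℕ
∑ []       f = 0
∑ (x ∷ xs) f = f x + ∑ xs f

∑-cong : (xs : List A) {f g : A → ℕ} → (∀ x → f x ≡ g x) → ∑ xs f ≡ ∑ xs g
∑-cong []       f≗g = refl
∑-cong (x ∷ xs) f≗g = cong₂ _+_ (f≗g x) (∑-cong xs f≗g)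

∑-zero : (xs : List A) → ∑ xs (λ _ → 0) ≡ 0
∑-zero []       = refl
∑-zero (x ∷ xs) = ∑-zero xs

∑-+ : (xs : List A) (f g : A → ℕ) → ∑ xs (λ x → f x + g x) ≡ ∑ xs f + ∑ xs g
∑-+ []       f g = refl
∑-+ (x ∷ xs) f g = trans (cong (f x + g x +_) (∑-+ xs f g))
                         (interchange ℕ.+-commutativeSemigroup (f x) (g x) (∑ xs f) (∑ xs g))

countᵇ-∷ : (P : A → Bool) (x : A) (xs : List A) → countᵇ P (x ∷ xs) ≡ 𝟙 (P x) + countᵇ P xs
countᵇ-∷ P x xs with P x
... | true  = refl
... | false = refl

countᵇ-as-∑ : (P : A → Bool) (xs : List A) → countᵇ P xs ≡ ∑ xs (λ x → 𝟙 (P x))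
countᵇ-as-∑ P []       = refl
countᵇ-as-∑ P (x ∷ xs) = trans (countᵇ-∷ P x xs) (cong (𝟙 (P x) +_) (countᵇ-as-∑ P xs))

countᵇ-map : (P : B → Bool) (f : A → B) (xs : List A) →
             countᵇ P (map f xs) ≡ countᵇ (λ x → P (f x)) xs
countᵇ-map P f []       = refl
countᵇ-map P f (x ∷ xs) with P (f x)
... | true  = cong suc (countᵇ-map P f xs)
... | false = countᵇ-map P f xs

countᵇ-mono : {P Q : A → Bool} → (∀ x → T (P x) → T (Q x)) → (xs : List A) → countᵇ P xs ≤ countᵇ Q xs
countᵇ-mono P⇒Q [] = z≤n
countᵇ-mono {P = P} {Q = Q} P⇒Q (x ∷ xs) with P x | Q x | P⇒Q x
... | true  | true  | _   = s≤s (countᵇ-mono P⇒Q xs)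
... | true  | false | P⇒Q = ⊥-elim (P⇒Q tt)
... | false | true  | _   = ℕ.m≤n⇒m≤1+n (countᵇ-mono P⇒Q xs)
... | false | false | _   = countᵇ-mono P⇒Q xs

countᵇ-none : {P : A → Bool} → (∀ x → ¬ T (P x)) → (xs : List A) → countᵇ P xs ≡ 0
countᵇ-none ¬P [] = refl
countᵇ-none {P = P} ¬P (x ∷ xs) with P x | ¬P x
... | true  | ¬Px = ⊥-elim (¬Px tt)
... | false | _   = countᵇ-none ¬P xs

countᵇ-partition : (P Q : A → Bool) (xs : List A) →
  countᵇ P xs ≡ countᵇ (λ x → P x ∧ Q x) xs + countᵇ (λ x → P x ∧ not (Q x)) xs
countᵇ-partition P Q [] = refl
countᵇ-partition P Q (x ∷ xs) with P x | Q x
... | true  | true  = cong suc (countᵇ-partition P Q xs)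
... | true  | false = trans (cong suc (countᵇ-partition P Q xs))
                            (sym (ℕ.+-suc (countᵇ (λ x → P x ∧ Q x) xs) _))
... | false | _     = countᵇ-partition P Q xs

∑-countᵇ-swap : (R : A → B → Bool) (xs : List A) (ys : List B) →
  ∑ xs (λ x → countᵇ (R x) ys) ≡ ∑ ys (λ y → countᵇ (λ x → R x y) xs)
∑-countᵇ-swap R []       ys = sym (∑-zero ys)
∑-countᵇ-swap R (x ∷ xs) ys = begin
  countᵇ (R x) ys + ∑ xs (λ x → countᵇ (R x) ys)
    ≡⟨ cong₂ _+_ (countᵇ-as-∑ (R x) ys) (∑-countᵇ-swap R xs ys) ⟩
  ∑ ys (λ y → 𝟙 (R x y)) + ∑ ys (λ y → countᵇ (λ x → R x y) xs)
    ≡⟨ ∑-+ ys (λ y → 𝟙 (R x y)) (λ y → countᵇ (λ x → R x y) xs) ⟨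
  ∑ ys (λ y → 𝟙 (R x y) + countᵇ (λ x → R x y) xs)
    ≡⟨ ∑-cong ys (λ y → sym (countᵇ-∷ (λ x → R x y) x xs)) ⟩
  ∑ ys (λ y → countᵇ (λ x → R x y) (x ∷ xs))
    ∎
  where open ≡-Reasoning

countᵇ-allFin-suc : ∀ {n} (P : Fin (suc n) → Bool) →
  countᵇ P (allFin (suc n)) ≡ 𝟙 (P Fin.zero) + countᵇ (λ i → P (Fin.suc i)) (allFin n)
countᵇ-allFin-suc {n} P = trans (countᵇ-∷ P Fin.zero _) (cong (𝟙 (P Fin.zero) +_)
  (trans (cong (countᵇ P) (sym (List.map-tabulate id Fin.suc))) (countᵇ-map P Fin.suc (allFin n))))

∣p∣≡countᵇ-lookup : ∀ {n} (S : Subset n) → ∣ S ∣ ≡ countᵇ (lookup S) (allFin n)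
∣p∣≡countᵇ-lookup []            = refl
∣p∣≡countᵇ-lookup (inside ∷ S)  =
  trans (cong suc (∣p∣≡countᵇ-lookup S)) (sym (countᵇ-allFin-suc (lookup (inside ∷ S))))
∣p∣≡countᵇ-lookup (outside ∷ S) =
  trans (∣p∣≡countᵇ-lookup S) (sym (countᵇ-allFin-suc (lookup (outside ∷ S))))

length-concatMap-const : (f : A → List B) {c : ℕ} → (∀ x → length (f x) ≡ c) →
  (xs : List A) → length (concatMap f xs) ≡ length xs ℕ.* c
length-concatMap-const f ∣f∣≡c []       = refl
length-concatMap-const f ∣f∣≡c (x ∷ xs) = trans (List.length-++ (f x))
  (cong₂ _+_ (∣f∣≡c x) (length-concatMap-const f ∣f∣≡c xs))

length-allSeqs : ∀ n p → length (allSeqs n p) ≡ n ^ p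
length-allSeqs n zero    = refl
length-allSeqs n (suc p) = begin
  length (allSeqs n (suc p))  ≡⟨ length-concatMap-const _ extend-length (allSeqs n p) ⟩
  length (allSeqs n p) ℕ.* n  ≡⟨ cong (ℕ._* n) (length-allSeqs n p) ⟩
  n ^ p ℕ.* n                 ≡⟨ ℕ.*-comm (n ^ p) n ⟩
  n ^ suc p                   ∎
  where
  open ≡-Reasoning
  extend-length : ∀ w → length (map (λ x → x ∷ w) (allFin n)) ≡ n
  extend-length w = trans (List.length-map _ (allFin n)) (List.length-tabulate id)

ℕ→ℚ≡mkℚ : ∀ k → ℕ→ℚ k ≡ mkℚ (ℤ.+ k) 0 (Coprimality.sym (Coprimality.1-coprimeTo k))
ℕ→ℚ≡mkℚ k = ℚ.normalize-coprime (Coprimality.sym (Coprimality.1-coprimeTo k))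

ℕ→ℚ-+ : ∀ a b → ℕ→ℚ (a + b) ≡ ℕ→ℚ a ℚ.+ ℕ→ℚ b
ℕ→ℚ-+ a b = trans
  (cong (_/ 1) (sym (cong₂ ℤ._+_ (ℤ.*-identityʳ (ℤ.+ a)) (ℤ.*-identityʳ (ℤ.+ b)))))
  (sym (cong₂ ℚ._+_ (ℕ→ℚ≡mkℚ a) (ℕ→ℚ≡mkℚ b)))

ℕ→ℚ-mono-≤ : ∀ {a b} → a ≤ b → ℕ→ℚ a ≤ℚ ℕ→ℚ b
ℕ→ℚ-mono-≤ {a} {b} a≤b rewrite ℕ→ℚ≡mkℚ a | ℕ→ℚ≡mkℚ b =
  ℚ.*≤* (ℤ.*-monoʳ-≤-nonNeg (ℤ.+ 1) (ℤ.+≤+ a≤b))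

ℕ→ℚ-pos : ∀ k .{{_ : NonZero k}} → ℚ.Positive (ℕ→ℚ k)
ℕ→ℚ-pos (suc k) rewrite ℕ→ℚ≡mkℚ (suc k) = _

ℕ→ℚ-nonNeg : ∀ k → ℚ.NonNegative (ℕ→ℚ k)
ℕ→ℚ-nonNeg k rewrite ℕ→ℚ≡mkℚ k = _

ℕ→ℚ-suc-* : ∀ k c → ℕ→ℚ (suc k) * c ≡ c ℚ.+ ℕ→ℚ k * c
ℕ→ℚ-suc-* k c = begin
  ℕ→ℚ (1 + k) * c             ≡⟨ cong (_* c) (ℕ→ℚ-+ 1 k) ⟩
  (ℚ.1ℚ ℚ.+ ℕ→ℚ k) * c        ≡⟨ ℚ.*-distribʳ-+ c ℚ.1ℚ (ℕ→ℚ k) ⟩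
  ℚ.1ℚ * c ℚ.+ ℕ→ℚ k * c      ≡⟨ cong (ℚ._+ ℕ→ℚ k * c) (ℚ.*-identityˡ c) ⟩
  c ℚ.+ ℕ→ℚ k * c             ∎
  where open ≡-Reasoning

countᵇ*≤∑ : (P : A → Bool) (f : A → ℕ) {c : ℚ} → (∀ x → T (P x) → c ≤ℚ ℕ→ℚ (f x)) →
  (xs : List A) → ℕ→ℚ (countᵇ P xs) * c ≤ℚ ℕ→ℚ (∑ xs f)
countᵇ*≤∑ P f {c} c≤f []       = ℚ.≤-reflexive (ℚ.*-zeroˡ c)
countᵇ*≤∑ P f {c} c≤f (x ∷ xs) with P x | c≤f x
... | true  | c≤fx = begin
  ℕ→ℚ (suc (countᵇ P xs)) * c        ≡⟨ ℕ→ℚ-suc-* (countᵇ P xs) c ⟩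
  c ℚ.+ ℕ→ℚ (countᵇ P xs) * c        ≤⟨ ℚ.+-mono-≤ (c≤fx tt) (countᵇ*≤∑ P f c≤f xs) ⟩
  ℕ→ℚ (f x) ℚ.+ ℕ→ℚ (∑ xs f)         ≡⟨ ℕ→ℚ-+ (f x) (∑ xs f) ⟨
  ℕ→ℚ (f x + ∑ xs f)                 ∎
  where open ℚ.≤-Reasoning
... | false | _    = begin
  ℕ→ℚ (countᵇ P xs) * c  ≤⟨ countᵇ*≤∑ P f c≤f xs ⟩
  ℕ→ℚ (∑ xs f)           ≤⟨ ℕ→ℚ-mono-≤ (ℕ.m≤n+m (∑ xs f) (f x)) ⟩
  ℕ→ℚ (f x + ∑ xs f)     ∎
  where open ℚ.≤-Reasoning

∑≤length* : (f : A → ℕ) {c : ℚ} → (∀ x → ℕ→ℚ (f x) ≤ℚ c) →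
  (xs : List A) → ℕ→ℚ (∑ xs f) ≤ℚ ℕ→ℚ (length xs) * c
∑≤length* f {c} f≤c []       = ℚ.≤-reflexive (sym (ℚ.*-zeroˡ c))
∑≤length* f {c} f≤c (x ∷ xs) = begin
  ℕ→ℚ (f x + ∑ xs f)               ≡⟨ ℕ→ℚ-+ (f x) (∑ xs f) ⟩
  ℕ→ℚ (f x) ℚ.+ ℕ→ℚ (∑ xs f)       ≤⟨ ℚ.+-mono-≤ (f≤c x) (∑≤length* f f≤c xs) ⟩
  c ℚ.+ ℕ→ℚ (length xs) * c        ≡⟨ ℕ→ℚ-suc-* (length xs) c ⟨
  ℕ→ℚ (suc (length xs)) * c        ∎
  where open ℚ.≤-Reasoning

≤ᵇ≡false⇒> : ∀ {p q} → (p ℚ.≤ᵇ q) ≡ false → q <ℚ p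
≤ᵇ≡false⇒> p≰ᵇq = ℚ.≰⇒> (λ p≤q → subst T p≰ᵇq (ℚ.≤⇒≤ᵇ p≤q))

T[a∧b∧c∧d]⇒T[a∧c]×T[d] : ∀ a b c d → T (a ∧ b ∧ c ∧ d) → T (a ∧ c) × T d
T[a∧b∧c∧d]⇒T[a∧c]×T[d] true true true true _ = tt , tt

module PoorWalks {n : ℕ} (G : Graph n) (r p : ℕ) (U : Subset n) (σ : ℚ) .{{_ : ℚ.Positive σ}} where

  τ : ℚ
  τ = σ * σ

  walks : List (Vec (Fin n) p)
  walks = allSeqs n p

  poorWalkIn : Fin n → Vec (Fin n) p → Bool
  poorWalkIn u W = isWalk G r W ∧ containedIn G u W ∧ isPoor G U τ W

  incident : Fin n → Vec (Fin n) p → Bool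
  incident u W = lookup U u ∧ poorWalkIn u W

  isGood : Fin n → Bool
  isGood u = ℕ→ℚ (poorWalksIn G r p U τ u) ℚ.≤ᵇ σ * ℕ→ℚ (n ^ p)

  bad : ℕ
  bad = countᵇ (λ u → lookup U u ∧ not (isGood u)) (allFin n)

  ∣U∣≡good+bad : ∣ U ∣ ≡ goodCount G r p U σ + bad
  ∣U∣≡good+bad = trans (∣p∣≡countᵇ-lookup U) (countᵇ-partition (lookup U) isGood (allFin n))

  -- The case analyses below avoid 'with' on Booleans that occur under ℕ→ℚ:
  -- abstracting over them makes Agda normalise the gcd computation inside
  -- ℕ→ℚ, which exhausts memory.
  incidences-of-member : ∀ u → lookup U u ≡ true → countᵇ (incident u) walks ≡ poorWalksIn G r p U τ u
  incidences-of-member u U∋u = cong (λ b → countᵇ (λ W → b ∧ poorWalkIn u W) walks) U∋u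

  bad⇒many-poor-walks : ∀ u → T (lookup U u ∧ not (isGood u)) →
    σ * ℕ→ℚ (n ^ p) ≤ℚ ℕ→ℚ (countᵇ (incident u) walks)
  bad⇒many-poor-walks u bad-u = ℚ.<⇒≤ (begin-strict
    σ * ℕ→ℚ (n ^ p)                  <⟨ ≤ᵇ≡false⇒> (Equivalence.to T-not-≡ (proj₂ U∋u∧bad)) ⟩
    ℕ→ℚ (poorWalksIn G r p U τ u)    ≡⟨ cong ℕ→ℚ (incidences-of-member u (Equivalence.to T-≡ (proj₁ U∋u∧bad))) ⟨
    ℕ→ℚ (countᵇ (incident u) walks)  ∎)
    where
    open ℚ.≤-Reasoning
    U∋u∧bad : T (lookup U u) × T (not (isGood u))
    U∋u∧bad = Equivalence.to (T-∧ {lookup U u} {not (isGood u)}) bad-u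

  0≤τn : 0ℚ ≤ℚ τ * ℕ→ℚ n
  0≤τn = ℚ.nonNegative⁻¹ (τ * ℕ→ℚ n)
    {{ℚ.nonNeg*nonNeg⇒nonNeg τ {{ℚ.pos⇒nonNeg τ {{ℚ.pos*pos⇒pos σ σ}}}} (ℕ→ℚ n) {{ℕ→ℚ-nonNeg n}}}}

  incidences-of-walk≤τn : ∀ W → ℕ→ℚ (countᵇ (λ u → incident u W) (allFin n)) ≤ℚ τ * ℕ→ℚ n
  incidences-of-walk≤τn W = by-richness (τ * ℕ→ℚ n ℚ.≤ᵇ ℕ→ℚ (richCount G U W)) refl
    where
    open ℚ.≤-Reasoning
    incident⇒rich∧poor : ∀ u → T (incident u W) → T (lookup U u ∧ containedIn G u W) × T (isPoor G U τ W)
    incident⇒rich∧poor u = T[a∧b∧c∧d]⇒T[a∧c]×T[d] (lookup U u) (isWalk G r W) (containedIn G u W) (isPoor G U τ W)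
    by-richness : ∀ b → (τ * ℕ→ℚ n ℚ.≤ᵇ ℕ→ℚ (richCount G U W)) ≡ b →
      ℕ→ℚ (countᵇ (λ u → incident u W) (allFin n)) ≤ℚ τ * ℕ→ℚ n
    by-richness false poor = ℚ.<⇒≤ (begin-strict
      ℕ→ℚ (countᵇ (λ u → incident u W) (allFin n))
        ≤⟨ ℕ→ℚ-mono-≤ (countᵇ-mono (λ u → proj₁ ∘ incident⇒rich∧poor u) (allFin n)) ⟩
      ℕ→ℚ (richCount G U W)  <⟨ ≤ᵇ≡false⇒> poor ⟩
      τ * ℕ→ℚ n              ∎)
    by-richness true rich = begin
      ℕ→ℚ (countᵇ (λ u → incident u W) (allFin n))
        ≡⟨ cong ℕ→ℚ (countᵇ-none (λ u → subst (λ b → T (not b)) rich ∘ proj₂ ∘ incident⇒rich∧poor u) (allFin n)) ⟩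
      0ℚ         ≤⟨ 0≤τn ⟩
      τ * ℕ→ℚ n  ∎

  bad*σnᵖ≤σn*σnᵖ : ℕ→ℚ bad * (σ * ℕ→ℚ (n ^ p)) ≤ℚ (σ * ℕ→ℚ n) * (σ * ℕ→ℚ (n ^ p))
  bad*σnᵖ≤σn*σnᵖ = begin
    ℕ→ℚ bad * (σ * ℕ→ℚ (n ^ p))
      ≤⟨ countᵇ*≤∑ _ (λ u → countᵇ (incident u) walks) bad⇒many-poor-walks (allFin n) ⟩
    ℕ→ℚ (∑ (allFin n) (λ u → countᵇ (incident u) walks))
      ≡⟨ cong ℕ→ℚ (∑-countᵇ-swap incident (allFin n) walks) ⟩
    ℕ→ℚ (∑ walks (λ W → countᵇ (λ u → incident u W) (allFin n)))
      ≤⟨ ∑≤length* _ incidences-of-walk≤τn walks ⟩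
    ℕ→ℚ (length walks) * (τ * ℕ→ℚ n)
      ≡⟨ cong (λ k → ℕ→ℚ k * (τ * ℕ→ℚ n)) (length-allSeqs n p) ⟩
    ℕ→ℚ (n ^ p) * (σ * σ * ℕ→ℚ n)
      ≡⟨ solve 3 (λ s m N → N :* (s :* s :* m) := (s :* m) :* (s :* N)) refl σ (ℕ→ℚ n) (ℕ→ℚ (n ^ p)) ⟩
    (σ * ℕ→ℚ n) * (σ * ℕ→ℚ (n ^ p))
      ∎
    where
    open ℚ.≤-Reasoning
    open +-*-Solver

bad≤σn : ∀ {n} (G : Graph n) (r p : ℕ) (U : Subset n) (σ : ℚ) .{{_ : ℚ.Positive σ}} →
  ℕ→ℚ (PoorWalks.bad G r p U σ) ≤ℚ σ * ℕ→ℚ n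
bad≤σn {zero}  G r p U σ = ℚ.≤-reflexive (sym (ℚ.*-zeroʳ σ))
bad≤σn {suc m} G r p U σ = ℚ.*-cancelʳ-≤-pos (σ * ℕ→ℚ (suc m ^ p))
  {{ℚ.pos*pos⇒pos σ (ℕ→ℚ (suc m ^ p)) {{ℕ→ℚ-pos (suc m ^ p) {{ℕ.m^n≢0 (suc m) p}}}}}}
  (PoorWalks.bad*σnᵖ≤σn*σnᵖ G r p U σ)

fact5p3 : (r p : ℕ) → 3 ≤ r → (σ : ℚ) → 0ℚ <ℚ σ →
    (n : ℕ) (G : Graph n) (U : Subset n) →
    ℕ→ℚ ∣ U ∣ - σ * ℕ→ℚ n ≤ℚ ℕ→ℚ (goodCount G r p U σ)
fact5p3 r p _ σ σ>0 n G U = begin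
  ℕ→ℚ ∣ U ∣ - σ * ℕ→ℚ n            ≤⟨ ℚ.+-monoʳ-≤ (ℕ→ℚ ∣ U ∣) (ℚ.neg-antimono-≤ (bad≤σn G r p U σ {{ℚ.positive σ>0}})) ⟩
  ℕ→ℚ ∣ U ∣ - ℕ→ℚ bad              ≡⟨ cong (λ k → ℕ→ℚ k - ℕ→ℚ bad) ∣U∣≡good+bad ⟩
  ℕ→ℚ (good + bad) - ℕ→ℚ bad       ≡⟨ cong (_- ℕ→ℚ bad) (ℕ→ℚ-+ good bad) ⟩
  ℕ→ℚ good ℚ.+ ℕ→ℚ bad - ℕ→ℚ bad   ≡⟨ solve 2 (λ x y → x :+ y :- y := x) refl (ℕ→ℚ good) (ℕ→ℚ bad) ⟩
  ℕ→ℚ good                         ∎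
  where
  open ℚ.≤-Reasoning
  open +-*-Solver
  open PoorWalks G r p U σ {{ℚ.positive σ>0}}
  good : ℕ
  good = goodCount G r p U σ
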